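{- Let $n$ be a positive integer. Then $\sigma^{**}(n)$ is odd if and only if $n$ is a power of $2$ (including $1=2^0$). More precisely, $\sigma^{**}(n)$ is divisible by $2^{\omega(n)}$ if $n$ is odd, and by $2^{\omega(n)-1}$ if $n$ is even.
   Context: $\omega(n)$ is the number of distinct prime factors of $n$. A divisor $d$ of $n$ is a unitary divisor if $\gcd(d,n/d)=1$; $\gcd_1(a,b)$ is the greatest common unitary divisor of $a$ and $b$; a divisor $d$ of $n$ is biunitary if $\gcd_1(d,n/d)=1$; $\sigma^{**}(n)$ is the sum of the biunitary divisors of $n$. (This function is multiplicative, and for a prime $p$ and $e\ge1$ written as $e=2s-1-\delta$ with $\delta\in\{0,1\}$, $\sigma^{**}(p^e)=\frac{(p^{s-\delta}-1)(p^s+1)}{p-1}$.) -}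

module Defs where

open import Data.Nat using (ℕ; zero; suc; _+_; _⊔_; _/_)
open import Data.Nat.Divisibility using (_∣_; _∣?_)
open import Data.Nat.GCD using (gcd)
open import Data.Nat.Primality using (Prime; prime?)
open import Data.Nat.Properties using (_≟_)
open import Data.List using (List; filter; foldr; length; upTo; map)
open import Data.Nat.ListAction using (sum)
open import Data.Product using (_×_)
open import Relation.Binary.PropositionalEquality using (_≡_)
open import Relation.Nullary.Decidable using (Dec; _×-dec_)

-- n / d, with the (irrelevant) convention quot n 0 = 0
quot : ℕ → ℕ → ℕ
quot n zero    = 0
quot n (suc k) = n / suc k

IsUnitaryDivisor : ℕ → ℕ → Set
IsUnitaryDivisor d m = d ∣ m × gcd d (quot m d) ≡ 1

isUnitaryDivisor? : ∀ d m → Dec (IsUnitaryDivisor d m)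
isUnitaryDivisor? d m = (d ∣? m) ×-dec (gcd d (quot m d) ≟ 1)

commonUnitaryDivisors : ℕ → ℕ → List ℕ
commonUnitaryDivisors a b =
  filter (λ d → isUnitaryDivisor? d a ×-dec isUnitaryDivisor? d b) (upTo (suc a))

-- gcd₁(a,b): the greatest common unitary divisor of a and b (for a ≥ 1)
gcd₁ : ℕ → ℕ → ℕ
gcd₁ a b = foldr _⊔_ 0 (commonUnitaryDivisors a b)

IsBiunitaryDivisor : ℕ → ℕ → Set
IsBiunitaryDivisor d n = d ∣ n × gcd₁ d (quot n d) ≡ 1

isBiunitaryDivisor? : ∀ d n → Dec (IsBiunitaryDivisor d n)
isBiunitaryDivisor? d n = (d ∣? n) ×-dec (gcd₁ d (quot n d) ≟ 1)

-- σ**(n): sum of the biunitary divisors of n (divisors of n ≥ 1 lie in 1..n)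
σ** : ℕ → ℕ
σ** n = sum (filter (λ d → isBiunitaryDivisor? d n) (map suc (upTo n)))

-- ω(n): number of distinct primes dividing n (primes dividing n ≥ 1 lie in 0..n)
ω : ℕ → ℕ
ω n = length (filter (λ p → prime? p ×-dec (p ∣? n)) (upTo (suc n)))

{-# OPTIONS --safe #-}

-- σ** is multiplicative: for coprime a and b, a unitary divisor of x y with x ∣ a and y ∣ b splits
-- uniquely into unitary divisors of x and of y, so the biunitary divisors of a b are exactly the
-- products of a biunitary divisor of a and one of b.  For odd n > 1, d ↦ n / d is a fixed-point-free
-- involution on the (odd) biunitary divisors of n, since a fixed point d = n / d would be a common
-- unitary divisor of d and n / d; hence σ**(n) is a sum of even pairs d + n / d.  In particular
-- σ**(p^e) is even for every odd prime power p^e > 1, and splitting off one odd prime power at a time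
-- gives 2^k ∣ σ**(n) whenever k distinct odd primes divide n.  Finally 1 is the only odd biunitary
-- divisor of 2^k, so σ**(2^k) is odd.
module Submission where

open import Defs

open import Algebra.Properties.CommutativeSemigroup using (interchange; xy∙z≈xz∙y)
open import Data.Empty using (⊥-elim)
open import Data.List using (List; []; _∷_; _++_; map; filter; length; upTo; applyUpTo; cartesianProduct; foldr)
open import Data.List.Membership.Propositional using (_∈_)
open import Data.List.Membership.Propositional.Properties using (∈-map⁺; ∈-map⁻; ∈-filter⁺; ∈-filter⁻; ∈-++⁺ˡ; ∈-++⁺ʳ; ∈-++⁻; ∈-cartesianProduct⁺; ∈-cartesianProduct⁻; ∈-upTo⁺; ∈-applyUpTo⁻)
open import Data.List.Membership.Propositional.Properties.WithK using (unique∧set⇒bag)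
open import Data.List.Properties using (map-++; map-∘; foldr-preservesᵇ; foldr-preservesᵒ; filter-accept; filter-reject; filter-all)
open import Data.List.Relation.Binary.BagAndSetEquality using (∼bag⇒↭)
open import Data.List.Relation.Binary.Disjoint.Propositional using (Disjoint)
open import Data.List.Relation.Binary.Permutation.Propositional using (_↭_)
open import Data.List.Relation.Unary.All as All using (All; []; _∷_)
open import Data.List.Relation.Unary.All.Properties as All using (all-filter)
open import Data.List.Relation.Unary.AllPairs using ([]; _∷_)
open import Data.List.Relation.Unary.Any as Any using (here; there)
open import Data.List.Relation.Unary.Unique.Propositional using (Unique)
import Data.List.Relation.Unary.Unique.Propositional.Properties as Unique
open import Data.Nat
open import Data.Nat.Coprimality as Coprime using (Coprime; coprime-divisor; coprime⇒gcd≡1; gcd≡1⇒coprime; 1-coprimeTo)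
open import Data.Nat.DivMod using (m*n/n≡m; m%n<n; %-distribˡ-+)
open import Data.Nat.Divisibility
open import Data.Nat.GCD using (gcd; gcd[m,n]∣m; gcd[m,n]∣n; gcd-greatest)
open import Data.Nat.Induction using (<-wellFounded)
open import Data.Nat.ListAction using (sum; product)
open import Data.Nat.ListAction.Properties using (sum-++; sum-↭)
open import Data.Nat.Primality using (Prime; prime?; prime[2]; ¬prime[1]; prime⇒irreducible; prime⇒nonTrivial; euclidsLemma)
open import Data.Nat.Primality.Factorisation using (factorise)
open import Data.Nat.Properties
open import Data.Product using (∃-syntax; ∃₂; _×_; _,_; proj₁; proj₂; uncurry; map₂)
open import Data.Sum using (inj₁; inj₂; [_,_])
open import Function using (_∘_)
open import Function.Bundles using (_⇔_; mk⇔; Equivalence)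
import Function.Properties.Equivalence as ⇔
open import Induction.WellFounded using (Acc; acc)
open import Relation.Binary.Definitions using (tri<; tri≈; tri>)
open import Relation.Binary.PropositionalEquality using (_≡_; _≢_; ≢-sym; refl; sym; trans; cong; cong₂; subst; subst₂; module ≡-Reasoning)
open import Relation.Nullary using (¬_; ¬?; yes; no)
open import Relation.Nullary.Decidable using (_×-dec_)

private
  variable
    A : Set
    a b c d e k m n p q u v w x y x′ y′ : ℕ

Unique-map⁺ : ∀ {B : Set} {f : A → B} {xs} → (∀ {x y} → x ∈ xs → y ∈ xs → f x ≡ f y → x ≡ y) →
              Unique xs → Unique (map f xs)
Unique-map⁺ inj [] = []
Unique-map⁺ inj (x∉xs ∷ xs!) =
  All.map⁺ (All.tabulate λ y∈xs fx≡fy → All.lookup x∉xs y∈xs (inj (here refl) (there y∈xs) fx≡fy))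
  ∷ Unique-map⁺ (λ x∈xs y∈xs → inj (there x∈xs) (there y∈xs)) xs!

unique∧sameElements⇒↭ : ∀ {xs ys : List A} → Unique xs → Unique ys →
                        (∀ {z} → z ∈ xs ⇔ z ∈ ys) → xs ↭ ys
unique∧sameElements⇒↭ xs! ys! xs≈ys = ∼bag⇒↭ (unique∧set⇒bag xs! ys! xs≈ys)

length≤1+length-filter-≢ : ∀ {xs} → Unique xs → length xs ≤ suc (length (filter (λ x → ¬? (x ≟ a)) xs))
length≤1+length-filter-≢         []            = z≤n
length≤1+length-filter-≢ {a} {x ∷ xs} (x∉xs ∷ xs!) with x ≟ a
... | yes x≡a = ≤-reflexive (cong (suc ∘ length) (sym (trans (filter-reject ≢a? (λ x≢a → x≢a x≡a))
                  (filter-all ≢a? (All.map (λ x≢y y≡a → x≢y (trans x≡a (sym y≡a))) x∉xs)))))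
  where ≢a? = λ y → ¬? (y ≟ a)
... | no x≢a rewrite filter-accept (λ y → ¬? (y ≟ a)) {xs = xs} x≢a = s≤s (length≤1+length-filter-≢ xs!)

sum-map-*ˡ : ∀ m xs → sum (map (m *_) xs) ≡ m * sum xs
sum-map-*ˡ m []       = sym (*-zeroʳ m)
sum-map-*ˡ m (x ∷ xs) = trans (cong (m * x +_) (sum-map-*ˡ m xs)) (sym (*-distribˡ-+ m x (sum xs)))

sum-cartesianProduct : ∀ xs ys → sum (map (uncurry _*_) (cartesianProduct xs ys)) ≡ sum xs * sum ys
sum-cartesianProduct []       ys = refl
sum-cartesianProduct (x ∷ xs) ys = begin
  sum (map (uncurry _*_) (map (x ,_) ys ++ cartesianProduct xs ys))
    ≡⟨ cong sum (map-++ (uncurry _*_) (map (x ,_) ys) _) ⟩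
  sum (map (uncurry _*_) (map (x ,_) ys) ++ map (uncurry _*_) (cartesianProduct xs ys))
    ≡⟨ sum-++ (map (uncurry _*_) (map (x ,_) ys)) _ ⟩
  sum (map (uncurry _*_) (map (x ,_) ys)) + sum (map (uncurry _*_) (cartesianProduct xs ys))
    ≡⟨ cong₂ _+_ (trans (cong sum (sym (map-∘ ys))) (sum-map-*ˡ x ys)) (sum-cartesianProduct xs ys) ⟩
  x * sum ys + sum xs * sum ys
    ≡⟨ sym (*-distribʳ-+ (sum ys) x (sum xs)) ⟩
  (x + sum xs) * sum ys ∎
  where open ≡-Reasoning

sum-++-map : ∀ f xs → sum (xs ++ map f xs) ≡ sum (map (λ x → x + f x) xs)
sum-++-map f xs = trans (sum-++ xs (map f xs)) (pairUp xs)
  where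
  pairUp : ∀ xs → sum xs + sum (map f xs) ≡ sum (map (λ x → x + f x) xs)
  pairUp []       = refl
  pairUp (x ∷ xs) = trans (interchange +-commutativeSemigroup x (sum xs) (f x) _) (cong (x + f x +_) (pairUp xs))

∣-sum : ∀ {xs} → All (d ∣_) xs → d ∣ sum xs
∣-sum {d} []             = d ∣0
∣-sum     (d∣x ∷ d∣xs) = ∣m∣n⇒∣m+n d∣x (∣-sum d∣xs)


m*n>0⇒m>0 : ∀ m → 0 < m * n → 0 < m
m*n>0⇒m>0 (suc m) _ = z<s

m*n>0⇒n>0 : ∀ m → 0 < m * n → 0 < n
m*n>0⇒n>0 {n} m mn>0 = m*n>0⇒m>0 n (subst (0 <_) (*-comm m n) mn>0)

m>0∧n>0⇒m*n>0 : 0 < m → 0 < n → 0 < m * n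
m>0∧n>0⇒m*n>0 {suc m} {suc n} _ _ = z<s

^-monoʳ-∣ : ∀ m → a ≤ b → m ^ a ∣ m ^ b
^-monoʳ-∣ {a} {b} m a≤b =
  divides (m ^ (b ∸ a)) (trans (cong (m ^_) (sym (m∸n+n≡m a≤b))) (^-distribˡ-+-* m (b ∸ a) a))

quot-complement : ∀ d → 0 < n → n ≡ d * e → quot n d ≡ e
quot-complement {e = e} (suc d) _ refl = trans (cong (_/ suc d) (*-comm (suc d) e)) (m*n/n≡m e (suc d))

quot-quot : 0 < n → d ∣ n → quot n (quot n d) ≡ d
quot-quot {n} {d} n>0 d∣n = let n≡dq = m∣n⇒n≡m*quotient d∣n in
  trans (cong (quot n) (quot-complement d n>0 n≡dq)) (quot-complement (quotient d∣n) n>0 (trans n≡dq (*-comm d _)))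

odd⇒%2≡1 : ∀ m → ¬ 2 ∣ m → m % 2 ≡ 1
odd⇒%2≡1 m 2∤m with m % 2 in m%2≡r | m%n<n m 2
... | 0           | _ = ⊥-elim (2∤m (m%n≡0⇒n∣m m 2 m%2≡r))
... | 1           | _ = refl
... | suc (suc _) | s≤s (s≤s ())

2∣odd+odd : ¬ 2 ∣ m → ¬ 2 ∣ n → 2 ∣ m + n
2∣odd+odd {m} {n} 2∤m 2∤n = m%n≡0⇒n∣m (m + n) 2 (begin
  (m + n) % 2          ≡⟨ %-distribˡ-+ m n 2 ⟩
  (m % 2 + n % 2) % 2  ≡⟨ cong₂ (λ r s → (r + s) % 2) (odd⇒%2≡1 m 2∤m) (odd⇒%2≡1 n 2∤n) ⟩
  0                    ∎)
  where open ≡-Reasoning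

coprime-∣ : Coprime a b → c ∣ a → d ∣ b → Coprime c d
coprime-∣ a⊥b c∣a d∣b (k∣c , k∣d) = a⊥b (∣-trans k∣c c∣a , ∣-trans k∣d d∣b)

coprime-*ʳ : Coprime a b → Coprime a c → Coprime a (b * c)
coprime-*ʳ a⊥b a⊥c (k∣a , k∣bc) = a⊥c (k∣a , coprime-divisor (coprime-∣ a⊥b k∣a ∣-refl) k∣bc)

coprime-^ˡ : ∀ e → Coprime a b → Coprime (a ^ e) b
coprime-^ˡ zero    _   = 1-coprimeTo _
coprime-^ˡ (suc e) a⊥b = Coprime.sym (coprime-*ʳ (Coprime.sym a⊥b) (Coprime.sym (coprime-^ˡ e a⊥b)))

∣-*-split : 0 < x → Coprime x y → w ∣ x * y → ∃₂ λ u v → w ≡ u * v × u ∣ x × v ∣ y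
∣-*-split {x} {y} {w} x>0 x⊥y w∣xy with gcd[m,n]∣m w x | gcd[m,n]∣n w x
... | divides r w≡rg | divides s x≡sg = g , r , trans w≡rg (*-comm r g) , gcd[m,n]∣n w x , r∣y
  where
  g = gcd w x
  instance
    g≢0 : NonZero g
    g≢0 = >-nonZero (m*n>0⇒n>0 s (subst (0 <_) x≡sg x>0))
  r⊥s : Coprime r s
  r⊥s {k} (k∣r , k∣s) = ∣1⇒≡1 (*-cancelʳ-∣ g (subst (k * g ∣_) (sym (*-identityˡ g)) kg∣g))
    where
    kg∣g : k * g ∣ g
    kg∣g = gcd-greatest (subst (k * g ∣_) (sym w≡rg) (*-monoˡ-∣ g k∣r))
                        (subst (k * g ∣_) (sym x≡sg) (*-monoˡ-∣ g k∣s))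
  r∣y : r ∣ y
  r∣y = coprime-divisor r⊥s (*-cancelʳ-∣ g (subst₂ _∣_ w≡rg xy≡syg w∣xy))
    where xy≡syg = trans (cong (_* y) x≡sg) (xy∙z≈xz∙y *-commutativeSemigroup s g y)

coprime-factorisation-unique : Coprime a b → u ∣ a → x ∣ a → v ∣ b → y ∣ b → u * v ≡ x * y → u ≡ x
coprime-factorisation-unique {u = u} {x} {v} {y} a⊥b u∣a x∣a v∣b y∣b uv≡xy = ∣-antisym
  (coprime-divisor (coprime-∣ a⊥b u∣a y∣b) (subst (u ∣_) (trans uv≡xy (*-comm x y)) (m∣m*n v)))
  (coprime-divisor (coprime-∣ a⊥b x∣a v∣b) (subst (x ∣_) (trans (sym uv≡xy) (*-comm u v)) (m∣m*n y)))

prime∤⇒coprime : Prime p → ¬ p ∣ m → Coprime p m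
prime∤⇒coprime pp p∤m (k∣p , k∣m) with prime⇒irreducible pp k∣p
... | inj₁ k≡1 = k≡1
... | inj₂ refl = ⊥-elim (p∤m k∣m)

prime∣prime^⇒≡ : ∀ e → Prime q → Prime p → q ∣ p ^ e → q ≡ p
prime∣prime^⇒≡ zero    qp _  q∣1 = ⊥-elim (¬prime[1] (subst Prime (∣1⇒≡1 q∣1) qp))
prime∣prime^⇒≡ (suc e) qp pp q∣pᵉ⁺¹ with euclidsLemma _ _ qp q∣pᵉ⁺¹
... | inj₂ q∣pᵉ = prime∣prime^⇒≡ e qp pp q∣pᵉ
... | inj₁ q∣p with prime⇒irreducible pp q∣p
...   | inj₁ refl = ⊥-elim (¬prime[1] qp)
...   | inj₂ q≡p  = q≡p

prime∣p^e*m⇒∣m : ∀ e → Prime q → Prime p → q ≢ p → q ∣ p ^ e * m → q ∣ m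
prime∣p^e*m⇒∣m e qp pp q≢p q∣pᵉm with euclidsLemma _ _ qp q∣pᵉm
... | inj₁ q∣pᵉ = ⊥-elim (q≢p (prime∣prime^⇒≡ e qp pp q∣pᵉ))
... | inj₂ q∣m  = q∣m

primeFactor : 1 < n → ∃[ p ] Prime p × p ∣ n
primeFactor {n} n>1 with factorise n {{>-nonZero (<-trans z<s n>1)}}
... | record { factors = [] ; isFactorisation = n≡1 } = ⊥-elim (<⇒≢ n>1 (sym n≡1))
... | record { factors = p ∷ ps ; isFactorisation = n≡pΠ ; factorsPrime = pp ∷ _ } =
  p , pp , divides (product ps) (trans n≡pΠ (*-comm p (product ps)))

∣2^k⇒even : ∀ k → d ∣ 2 ^ k → 1 < d → 2 ∣ d
∣2^k⇒even k d∣2ᵏ d>1 with primeFactor d>1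
... | p , pp , p∣d = subst (_∣ _) (prime∣prime^⇒≡ k pp prime[2] (∣-trans p∣d d∣2ᵏ)) p∣d

factorOut : Prime p → 0 < n → ∃₂ λ e m → n ≡ p ^ e * m × ¬ p ∣ m
factorOut {p} pp n>0 = go n>0 (<-wellFounded _)
  where
  go : 0 < n → Acc _<_ n → ∃₂ λ e m → n ≡ p ^ e * m × ¬ p ∣ m
  go {n} n>0 (acc rec) with p ∣? n
  ... | no p∤n = 0 , n , sym (*-identityˡ n) , p∤n
  ... | yes (divides k n≡kp) =
    let k>0 = m*n>0⇒m>0 k (subst (0 <_) n≡kp n>0)
        k<n = subst (k <_) (sym n≡kp) (m<m*n k p {{>-nonZero k>0}} (nonTrivial⇒n>1 p {{prime⇒nonTrivial pp}}))
        (e , m , k≡pᵉm , p∤m) = go k>0 (rec k<n)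
    in suc e , m , trans n≡kp (trans (cong (_* p) k≡pᵉm) (trans (*-comm _ p) (sym (*-assoc p _ m)))) , p∤m

-- Unitary and biunitary divisors

UnitaryDivisor : ℕ → ℕ → Set
UnitaryDivisor u m = ∃[ v ] m ≡ u * v × Coprime u v

Coprime₁ : ℕ → ℕ → Set
Coprime₁ a b = ∀ {u} → UnitaryDivisor u a → UnitaryDivisor u b → u ≡ 1

BiunitaryDivisor : ℕ → ℕ → Set
BiunitaryDivisor d n = ∃[ e ] n ≡ d * e × Coprime₁ d e

unitaryDivisor⇒∣ : UnitaryDivisor u m → u ∣ m
unitaryDivisor⇒∣ {u} (v , m≡uv , _) = divides v (trans m≡uv (*-comm u v))

biunitaryDivisor⇒∣ : BiunitaryDivisor d n → d ∣ n
biunitaryDivisor⇒∣ {d} (e , n≡de , _) = divides e (trans n≡de (*-comm d e))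

unitaryDivisor-refl : ∀ m → UnitaryDivisor m m
unitaryDivisor-refl m = 1 , sym (*-identityʳ m) , λ (_ , k∣1) → ∣1⇒≡1 k∣1

1-unitaryDivisor : ∀ m → UnitaryDivisor 1 m
1-unitaryDivisor m = m , sym (*-identityˡ m) , 1-coprimeTo m

unitaryDivisor-*ʳ : UnitaryDivisor u x → Coprime u y → UnitaryDivisor u (x * y)
unitaryDivisor-*ʳ {u} {y = y} (v , x≡uv , u⊥v) u⊥y =
  v * y , trans (cong (_* y) x≡uv) (*-assoc u v y) , coprime-*ʳ u⊥v u⊥y

unitaryDivisor-*ˡ : UnitaryDivisor u y → Coprime u x → UnitaryDivisor u (x * y)
unitaryDivisor-*ˡ {u} {y} {x} u∥y u⊥x = subst (UnitaryDivisor u) (*-comm y x) (unitaryDivisor-*ʳ u∥y u⊥x)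

unitaryDivisor-split : 0 < x * y → u ∣ x → v ∣ y → UnitaryDivisor (u * v) (x * y) →
                       UnitaryDivisor u x × UnitaryDivisor v y
unitaryDivisor-split {x} {y} {u} {v} xy>0 (divides a x≡au) (divides b y≡bv) (q , xy≡uvq , uv⊥q) =
  (a , trans x≡au (*-comm a u) , coprime-∣ uv⊥q (m∣m*n v) (divides b (trans q≡ab (*-comm a b)))) ,
  (b , trans y≡bv (*-comm b v) , coprime-∣ uv⊥q (n∣m*n u) (divides a q≡ab))
  where
  instance
    uv≢0 : NonZero (u * v)
    uv≢0 = >-nonZero (m*n>0⇒m>0 (u * v) (subst (0 <_) xy≡uvq xy>0))
  q≡ab : q ≡ a * b
  q≡ab = *-cancelˡ-≡ q (a * b) (u * v) (begin
    u * v * q        ≡⟨ sym xy≡uvq ⟩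
    x * y            ≡⟨ cong₂ _*_ x≡au y≡bv ⟩
    a * u * (b * v)  ≡⟨ interchange *-commutativeSemigroup a u b v ⟩
    a * b * (u * v)  ≡⟨ *-comm (a * b) (u * v) ⟩
    u * v * (a * b)  ∎)
    where open ≡-Reasoning

unitaryDivisor-*⁻ : Coprime x y → 0 < x * y → UnitaryDivisor w (x * y) →
                    ∃₂ λ u v → w ≡ u * v × UnitaryDivisor u x × UnitaryDivisor v y
unitaryDivisor-*⁻ {x} x⊥y xy>0 w∥xy with ∣-*-split (m*n>0⇒m>0 x xy>0) x⊥y (unitaryDivisor⇒∣ w∥xy)
... | u , v , refl , u∣x , v∣y = u , v , refl , unitaryDivisor-split xy>0 u∣x v∣y w∥xy

Coprime₁-sym : Coprime₁ a b → Coprime₁ b a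
Coprime₁-sym a⊥₁b ub ua = a⊥₁b ua ub

Coprime₁[d,d]⇒d≡1 : Coprime₁ d d → d ≡ 1
Coprime₁[d,d]⇒d≡1 {d} d⊥₁d = d⊥₁d (unitaryDivisor-refl d) (unitaryDivisor-refl d)

Coprime₁-*⇔ : Coprime a b → x ∣ a → x′ ∣ a → y ∣ b → y′ ∣ b → 0 < x * y → 0 < x′ * y′ →
              Coprime₁ (x * y) (x′ * y′) ⇔ (Coprime₁ x x′ × Coprime₁ y y′)
Coprime₁-*⇔ {x = x} {x′} {y} {y′} a⊥b x∣a x′∣a y∣b y′∣b xy>0 x′y′>0 = mk⇔ restrict combine
  where
  restrict : Coprime₁ (x * y) (x′ * y′) → Coprime₁ x x′ × Coprime₁ y y′
  restrict xy⊥₁x′y′ =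
    (λ u∥x u∥x′ → let u∣a = ∣-trans (unitaryDivisor⇒∣ u∥x) x∣a in
      xy⊥₁x′y′ (unitaryDivisor-*ʳ u∥x (coprime-∣ a⊥b u∣a y∣b))
               (unitaryDivisor-*ʳ u∥x′ (coprime-∣ a⊥b u∣a y′∣b))) ,
    (λ u∥y u∥y′ → let u∣b = ∣-trans (unitaryDivisor⇒∣ u∥y) y∣b in
      xy⊥₁x′y′ (unitaryDivisor-*ˡ u∥y (coprime-∣ (Coprime.sym a⊥b) u∣b x∣a))
               (unitaryDivisor-*ˡ u∥y′ (coprime-∣ (Coprime.sym a⊥b) u∣b x′∣a)))
  combine : Coprime₁ x x′ × Coprime₁ y y′ → Coprime₁ (x * y) (x′ * y′)
  combine (x⊥₁x′ , y⊥₁y′) w∥xy w∥x′y′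
    with unitaryDivisor-*⁻ (coprime-∣ a⊥b x∣a y∣b) xy>0 w∥xy
       | unitaryDivisor-*⁻ (coprime-∣ a⊥b x′∣a y′∣b) x′y′>0 w∥x′y′
  ... | u , v , refl , u∥x , v∥y | u′ , v′ , uv≡u′v′ , u′∥x′ , v′∥y′ =
    cong₂ _*_ (x⊥₁x′ u∥x (subst (λ t → UnitaryDivisor t x′) (sym u≡u′) u′∥x′))
              (y⊥₁y′ v∥y (subst (λ t → UnitaryDivisor t y′) (sym v≡v′) v′∥y′))
    where
    u∣a  = ∣-trans (unitaryDivisor⇒∣ u∥x) x∣a
    u′∣a = ∣-trans (unitaryDivisor⇒∣ u′∥x′) x′∣a
    v∣b  = ∣-trans (unitaryDivisor⇒∣ v∥y) y∣b
    v′∣b = ∣-trans (unitaryDivisor⇒∣ v′∥y′) y′∣b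
    u≡u′ = coprime-factorisation-unique a⊥b u∣a u′∣a v∣b v′∣b uv≡u′v′
    v≡v′ = coprime-factorisation-unique (Coprime.sym a⊥b) v∣b v′∣b u∣a u′∣a
             (trans (*-comm v u) (trans uv≡u′v′ (*-comm u′ v′)))

biunitaryDivisor-*⇔ : Coprime a b → 0 < a * b → x ∣ a → y ∣ b →
                      BiunitaryDivisor (x * y) (a * b) ⇔ (BiunitaryDivisor x a × BiunitaryDivisor y b)
biunitaryDivisor-*⇔ {a} {b} {x} {y} a⊥b ab>0 x∣a y∣b = mk⇔ split join
  where
  ab≡xy*pq : ∀ {p q} → a ≡ x * p → b ≡ y * q → a * b ≡ x * y * (p * q)
  ab≡xy*pq {p} {q} a≡xp b≡yq = trans (cong₂ _*_ a≡xp b≡yq) (interchange *-commutativeSemigroup x p y q)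
  Coprime₁-*⇔′ : ∀ {p q} → a ≡ x * p → b ≡ y * q →
                 Coprime₁ (x * y) (p * q) ⇔ (Coprime₁ x p × Coprime₁ y q)
  Coprime₁-*⇔′ {p} {q} a≡xp b≡yq = Coprime₁-*⇔ a⊥b x∣a (divides x a≡xp) y∣b
    (divides y b≡yq) (m*n>0⇒m>0 (x * y) ab>0′) (m*n>0⇒n>0 (x * y) ab>0′)
    where ab>0′ = subst (0 <_) (ab≡xy*pq a≡xp b≡yq) ab>0
  split : BiunitaryDivisor (x * y) (a * b) → BiunitaryDivisor x a × BiunitaryDivisor y b
  split (r , ab≡xyr , xy⊥₁r) = (a/x , a≡x*a/x , proj₁ restricted) , (b/y , b≡y*b/y , proj₂ restricted)
    where
    a/x = quotient x∣a
    b/y = quotient y∣b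
    a≡x*a/x = m∣n⇒n≡m*quotient x∣a
    b≡y*b/y = m∣n⇒n≡m*quotient y∣b
    r≡a/x*b/y : r ≡ a/x * b/y
    r≡a/x*b/y = *-cancelˡ-≡ r (a/x * b/y) (x * y) {{>-nonZero (m*n>0⇒m>0 (x * y) (subst (0 <_) ab≡xyr ab>0))}}
                  (trans (sym ab≡xyr) (ab≡xy*pq a≡x*a/x b≡y*b/y))
    restricted = Equivalence.to (Coprime₁-*⇔′ a≡x*a/x b≡y*b/y) (subst (Coprime₁ (x * y)) r≡a/x*b/y xy⊥₁r)
  join : BiunitaryDivisor x a × BiunitaryDivisor y b → BiunitaryDivisor (x * y) (a * b)
  join ((p , a≡xp , x⊥₁p) , (q , b≡yq , y⊥₁q)) =
    p * q , ab≡xy*pq a≡xp b≡yq , Equivalence.from (Coprime₁-*⇔′ a≡xp b≡yq) (x⊥₁p , y⊥₁q)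

biunitaryDivisor-complement : 0 < n → BiunitaryDivisor d n → BiunitaryDivisor (quot n d) n
biunitaryDivisor-complement {n} {d} n>0 (e , n≡de , d⊥₁e) =
  subst (λ t → BiunitaryDivisor t n) (sym (quot-complement d n>0 n≡de))
        (d , trans n≡de (*-comm d e) , Coprime₁-sym d⊥₁e)

biunitaryDivisor-≢complement : 1 < n → BiunitaryDivisor d n → d ≢ quot n d
biunitaryDivisor-≢complement {n} {d} n>1 (e , n≡de , d⊥₁e) d≡n/d = <⇒≢ n>1 (sym n≡1)
  where
  e≡d : e ≡ d
  e≡d = trans (sym (quot-complement d (<-trans z<s n>1) n≡de)) (sym d≡n/d)
  d≡1 : d ≡ 1
  d≡1 = Coprime₁[d,d]⇒d≡1 (subst (Coprime₁ d) e≡d d⊥₁e)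
  n≡1 : n ≡ 1
  n≡1 = trans n≡de (cong₂ _*_ d≡1 (trans e≡d d≡1))


∣-quot⇔∃complement : ∀ (P : ℕ → ℕ → Set) → 0 < n →
                     (d ∣ n × P d (quot n d)) ⇔ (∃[ e ] n ≡ d * e × P d e)
∣-quot⇔∃complement {n} {d} P n>0 = mk⇔
  (λ (d∣n , Pdq) → let n≡dq = m∣n⇒n≡m*quotient d∣n in
     quotient d∣n , n≡dq , subst (P d) (quot-complement d n>0 n≡dq) Pdq)
  (λ (e , n≡de , Pde) → divides e (trans n≡de (*-comm d e)) , subst (P d) (sym (quot-complement d n>0 n≡de)) Pde)

isUnitaryDivisor⇔ : 0 < m → IsUnitaryDivisor u m ⇔ UnitaryDivisor u m
isUnitaryDivisor⇔ m>0 = ⇔.trans (∣-quot⇔∃complement (λ u v → gcd u v ≡ 1) m>0)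
  (mk⇔ (map₂ (map₂ gcd≡1⇒coprime)) (map₂ (map₂ coprime⇒gcd≡1)))

∈-commonUnitaryDivisors⇔ : 0 < a → 0 < b →
                           u ∈ commonUnitaryDivisors a b ⇔ (UnitaryDivisor u a × UnitaryDivisor u b)
∈-commonUnitaryDivisors⇔ {a} {b} a>0 b>0 = mk⇔
  (λ u∈ → let (u∣a , u∣b) = proj₂ (∈-filter⁻ P? {xs = upTo (suc a)} u∈) in
     Equivalence.to (isUnitaryDivisor⇔ a>0) u∣a , Equivalence.to (isUnitaryDivisor⇔ b>0) u∣b)
  (λ (u∥a , u∥b) → ∈-filter⁺ P? (∈-upTo⁺ (s≤s (∣⇒≤ {{>-nonZero a>0}} (unitaryDivisor⇒∣ u∥a))))
     (Equivalence.from (isUnitaryDivisor⇔ a>0) u∥a , Equivalence.from (isUnitaryDivisor⇔ b>0) u∥b))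
  where P? = λ d → isUnitaryDivisor? d a ×-dec isUnitaryDivisor? d b

gcd₁≡1⇔Coprime₁ : 0 < a → 0 < b → gcd₁ a b ≡ 1 ⇔ Coprime₁ a b
gcd₁≡1⇔Coprime₁ {a} {b} a>0 b>0 = mk⇔
  (λ gcd₁≡1 {u} u∥a@(v , a≡uv , _) u∥b → ≤-antisym
     (subst (u ≤_) gcd₁≡1 (≤-max (Equivalence.from common⇔ (u∥a , u∥b))))
     (m*n>0⇒m>0 u (subst (0 <_) a≡uv a>0)))
  (λ a⊥₁b → ≤-antisym
     (max≤ (All.tabulate λ u∈ → ≤-reflexive (uncurry a⊥₁b (Equivalence.to common⇔ u∈))))
     (≤-max (Equivalence.from common⇔ (1-unitaryDivisor a , 1-unitaryDivisor b))))
  where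
  common⇔ : u ∈ commonUnitaryDivisors a b ⇔ (UnitaryDivisor u a × UnitaryDivisor u b)
  common⇔ = ∈-commonUnitaryDivisors⇔ a>0 b>0
  ≤-max : ∀ {xs} → u ∈ xs → u ≤ foldr _⊔_ 0 xs
  ≤-max {u} u∈xs =
    foldr-preservesᵒ (λ x y → [ m≤n⇒m≤n⊔o y , m≤n⇒m≤o⊔n x ]) 0 _ (inj₂ (Any.map ≤-reflexive u∈xs))
  max≤ : ∀ {xs} → All (_≤ k) xs → foldr _⊔_ 0 xs ≤ k
  max≤ = foldr-preservesᵇ ⊔-lub z≤n

isBiunitaryDivisor⇔ : 0 < n → IsBiunitaryDivisor d n ⇔ BiunitaryDivisor d n
isBiunitaryDivisor⇔ {n} {d} n>0 = ⇔.trans (∣-quot⇔∃complement (λ d e → gcd₁ d e ≡ 1) n>0)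
  (mk⇔ (λ (e , n≡de , g) → e , n≡de , Equivalence.to (gcd₁≡1⇔Coprime₁′ n≡de) g)
       (λ (e , n≡de , c) → e , n≡de , Equivalence.from (gcd₁≡1⇔Coprime₁′ n≡de) c))
  where
  gcd₁≡1⇔Coprime₁′ : n ≡ d * e → gcd₁ d e ≡ 1 ⇔ Coprime₁ d e
  gcd₁≡1⇔Coprime₁′ n≡de = let de>0 = subst (0 <_) n≡de n>0 in
    gcd₁≡1⇔Coprime₁ (m*n>0⇒m>0 d de>0) (m*n>0⇒n>0 d de>0)

-- σ** as a sum over a list of its biunitary divisors

biunitaryDivisors : ℕ → List ℕ
biunitaryDivisors n = filter (λ d → isBiunitaryDivisor? d n) (map suc (upTo n))

biunitaryDivisors-unique : ∀ n → Unique (biunitaryDivisors n)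
biunitaryDivisors-unique n = Unique.filter⁺ _ (Unique.map⁺ suc-injective (Unique.upTo⁺ n))

∈-biunitaryDivisors⇔ : 0 < n → d ∈ biunitaryDivisors n ⇔ BiunitaryDivisor d n
∈-biunitaryDivisors⇔ {n} {d} n>0 = mk⇔
  (λ d∈ → Equivalence.to (isBiunitaryDivisor⇔ n>0) (proj₂ (∈-filter⁻ B? {xs = map suc (upTo n)} d∈)))
  (λ d∥n → ∈-filter⁺ B? (∈-1…n (m*n>0⇒m>0 d (subst (0 <_) (proj₁ (proj₂ d∥n)) n>0))
                                (∣⇒≤ {{>-nonZero n>0}} (biunitaryDivisor⇒∣ d∥n)))
                        (Equivalence.from (isBiunitaryDivisor⇔ n>0) d∥n))
  where
  B? = λ d → isBiunitaryDivisor? d n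
  ∈-1…n : ∀ {k} → 0 < k → k ≤ n → k ∈ map suc (upTo n)
  ∈-1…n {suc k} _ k<n = ∈-map⁺ suc (∈-upTo⁺ k<n)

σ**≡sum : 0 < n → ∀ {xs} → Unique xs → (∀ {d} → d ∈ xs ⇔ BiunitaryDivisor d n) → σ** n ≡ sum xs
σ**≡sum {n} n>0 xs! ∈xs⇔ = sum-↭ (unique∧sameElements⇒↭ (biunitaryDivisors-unique n) xs!
  (⇔.trans (∈-biunitaryDivisors⇔ n>0) (⇔.sym ∈xs⇔)))

σ**-multiplicative : 0 < a → 0 < b → Coprime a b → σ** (a * b) ≡ σ** a * σ** b
σ**-multiplicative {a} {b} a>0 b>0 a⊥b =
  trans (σ**≡sum ab>0 products! ∈products⇔) (sum-cartesianProduct (biunitaryDivisors a) (biunitaryDivisors b))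
  where
  ab>0 = m>0∧n>0⇒m*n>0 a>0 b>0
  pairs = cartesianProduct (biunitaryDivisors a) (biunitaryDivisors b)
  ∈pairs⇔ : (x , y) ∈ pairs ⇔ (BiunitaryDivisor x a × BiunitaryDivisor y b)
  ∈pairs⇔ = mk⇔
    (λ xy∈ → let (x∈ , y∈) = ∈-cartesianProduct⁻ _ _ xy∈ in
       Equivalence.to (∈-biunitaryDivisors⇔ a>0) x∈ , Equivalence.to (∈-biunitaryDivisors⇔ b>0) y∈)
    (λ (x∥a , y∥b) → ∈-cartesianProduct⁺ (Equivalence.from (∈-biunitaryDivisors⇔ a>0) x∥a)
                                          (Equivalence.from (∈-biunitaryDivisors⇔ b>0) y∥b))
  product-injective : ∀ {s t} → s ∈ pairs → t ∈ pairs → uncurry _*_ s ≡ uncurry _*_ t → s ≡ t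
  product-injective {x , y} {x′ , y′} s∈ t∈ xy≡x′y′ = cong₂ _,_
    (coprime-factorisation-unique a⊥b x∣a x′∣a y∣b y′∣b xy≡x′y′)
    (coprime-factorisation-unique (Coprime.sym a⊥b) y∣b y′∣b x∣a x′∣a
      (trans (*-comm y x) (trans xy≡x′y′ (*-comm x′ y′))))
    where
    x∣a  = biunitaryDivisor⇒∣ (proj₁ (Equivalence.to ∈pairs⇔ s∈))
    y∣b  = biunitaryDivisor⇒∣ (proj₂ (Equivalence.to ∈pairs⇔ s∈))
    x′∣a = biunitaryDivisor⇒∣ (proj₁ (Equivalence.to ∈pairs⇔ t∈))
    y′∣b = biunitaryDivisor⇒∣ (proj₂ (Equivalence.to ∈pairs⇔ t∈))
  products! : Unique (map (uncurry _*_) pairs)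
  products! = Unique-map⁺ product-injective
    (Unique.cartesianProduct⁺ (biunitaryDivisors-unique a) (biunitaryDivisors-unique b))
  ∈products⇔ : d ∈ map (uncurry _*_) pairs ⇔ BiunitaryDivisor d (a * b)
  ∈products⇔ = mk⇔ to from
    where
    to : d ∈ map (uncurry _*_) pairs → BiunitaryDivisor d (a * b)
    to d∈ with ∈-map⁻ (uncurry _*_) d∈
    ... | (x , y) , xy∈ , refl = let (x∥a , y∥b) = Equivalence.to ∈pairs⇔ xy∈ in
      Equivalence.from (biunitaryDivisor-*⇔ a⊥b ab>0 (biunitaryDivisor⇒∣ x∥a) (biunitaryDivisor⇒∣ y∥b)) (x∥a , y∥b)
    from : BiunitaryDivisor d (a * b) → d ∈ map (uncurry _*_) pairs
    from d∥ab with ∣-*-split a>0 a⊥b (biunitaryDivisor⇒∣ d∥ab)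
    ... | x , y , refl , x∣a , y∣b =
      ∈-map⁺ (uncurry _*_) (Equivalence.from ∈pairs⇔ (Equivalence.to (biunitaryDivisor-*⇔ a⊥b ab>0 x∣a y∣b) d∥ab))

lowerBiunitaryDivisors : ℕ → List ℕ
lowerBiunitaryDivisors n = filter (λ d → d <? quot n d) (biunitaryDivisors n)

∈-lowerBiunitaryDivisors⁻ : 0 < n → d ∈ lowerBiunitaryDivisors n → BiunitaryDivisor d n × d < quot n d
∈-lowerBiunitaryDivisors⁻ {n} n>0 d∈ =
  let (d∈all , d<n/d) = ∈-filter⁻ (λ d → d <? quot n d) {xs = biunitaryDivisors n} d∈ in
  Equivalence.to (∈-biunitaryDivisors⇔ n>0) d∈all , d<n/d

σ**≡sum-pairs : 1 < n → σ** n ≡ sum (map (λ d → d + quot n d) (lowerBiunitaryDivisors n))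
σ**≡sum-pairs {n} n>1 =
  trans (σ**≡sum n>0 (Unique.++⁺ lower! (Unique-map⁺ complement-injective lower!) disjoint) ∈pairs⇔)
        (sum-++-map (quot n) lower)
  where
  n>0 = <-trans z<s n>1
  lower = lowerBiunitaryDivisors n
  lower! : Unique lower
  lower! = Unique.filter⁺ _ (biunitaryDivisors-unique n)
  ∈lower⁻ : d ∈ lower → BiunitaryDivisor d n × d < quot n d
  ∈lower⁻ = ∈-lowerBiunitaryDivisors⁻ n>0
  n/[n/d]≡d : d ∈ lower → quot n (quot n d) ≡ d
  n/[n/d]≡d d∈ = quot-quot n>0 (biunitaryDivisor⇒∣ (proj₁ (∈lower⁻ d∈)))
  complement-injective : ∀ {d d′} → d ∈ lower → d′ ∈ lower → quot n d ≡ quot n d′ → d ≡ d′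
  complement-injective d∈ d′∈ n/d≡n/d′ =
    trans (sym (n/[n/d]≡d d∈)) (trans (cong (quot n) n/d≡n/d′) (n/[n/d]≡d d′∈))
  disjoint : Disjoint lower (map (quot n) lower)
  disjoint (d∈ , d∈map) with ∈-map⁻ (quot n) d∈map
  ... | d′ , d′∈ , refl =
    <-asym (proj₂ (∈lower⁻ d∈)) (subst (_< quot n d′) (sym (n/[n/d]≡d d′∈)) (proj₂ (∈lower⁻ d′∈)))
  ∈pairs⇔ : d ∈ lower ++ map (quot n) lower ⇔ BiunitaryDivisor d n
  ∈pairs⇔ {d} = mk⇔ to from
    where
    to : d ∈ lower ++ map (quot n) lower → BiunitaryDivisor d n
    to d∈ with ∈-++⁻ lower d∈
    ... | inj₁ d∈lower = proj₁ (∈lower⁻ d∈lower)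
    ... | inj₂ d∈map with ∈-map⁻ (quot n) d∈map
    ...   | d′ , d′∈ , refl = biunitaryDivisor-complement n>0 (proj₁ (∈lower⁻ d′∈))
    from : BiunitaryDivisor d n → d ∈ lower ++ map (quot n) lower
    from d∥n with <-cmp d (quot n d)
    ... | tri< d<n/d _ _ = ∈-++⁺ˡ (∈-filter⁺ _ (Equivalence.from (∈-biunitaryDivisors⇔ n>0) d∥n) d<n/d)
    ... | tri≈ _ d≡n/d _ = ⊥-elim (biunitaryDivisor-≢complement n>1 d∥n d≡n/d)
    ... | tri> _ _ d>n/d = ∈-++⁺ʳ lower (subst (_∈ map (quot n) lower) n/[n/d]≡d′ (∈-map⁺ (quot n)
            (∈-filter⁺ _ (Equivalence.from (∈-biunitaryDivisors⇔ n>0) (biunitaryDivisor-complement n>0 d∥n))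
                         (subst (quot n d <_) (sym n/[n/d]≡d′) d>n/d))))
      where n/[n/d]≡d′ = quot-quot n>0 (biunitaryDivisor⇒∣ d∥n)

σ**-even : 1 < n → ¬ 2 ∣ n → 2 ∣ σ** n
σ**-even {n} n>1 2∤n = subst (2 ∣_) (sym (σ**≡sum-pairs n>1)) (∣-sum (All.map⁺ (All.tabulate pair-even)))
  where
  odd-divisor : k ∣ n → ¬ 2 ∣ k
  odd-divisor k∣n 2∣k = 2∤n (∣-trans 2∣k k∣n)
  pair-even : d ∈ lowerBiunitaryDivisors n → 2 ∣ d + quot n d
  pair-even d∈ = let d∥n = proj₁ (∈-lowerBiunitaryDivisors⁻ (<-trans z<s n>1) d∈) in
    2∣odd+odd (odd-divisor (biunitaryDivisor⇒∣ d∥n))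
              (odd-divisor (biunitaryDivisor⇒∣ (biunitaryDivisor-complement (<-trans z<s n>1) d∥n)))

σ**-odd : (∀ {d} → 1 < d → d ∣ n → 2 ∣ d) → 0 < n → ¬ 2 ∣ σ** n
σ**-odd {suc m} nontrivial-even n>0 2∣σ** = 2∤1 (∣m+n∣m⇒∣n 2∣rest+1 (∣-sum (All.tabulate rest-even)))
  where
  B? = λ d → isBiunitaryDivisor? d (suc m)
  -- map suc (upTo (suc m)) unfolds definitionally to 1 ∷ map suc (applyUpTo suc m), the candidates 2 … n.
  rest = filter B? (map suc (applyUpTo suc m))
  1∥n : IsBiunitaryDivisor 1 (suc m)
  1∥n = Equivalence.from (isBiunitaryDivisor⇔ n>0)
    (suc m , sym (*-identityˡ (suc m)) , λ u∥1 _ → ∣1⇒≡1 (unitaryDivisor⇒∣ u∥1))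
  2∣rest+1 : 2 ∣ sum rest + 1
  2∣rest+1 = subst (2 ∣_) (trans (cong sum (filter-accept B? 1∥n)) (+-comm 1 (sum rest))) 2∣σ**
  rest-even : d ∈ rest → 2 ∣ d
  rest-even d∈ with ∈-filter⁻ B? {xs = map suc (applyUpTo suc m)} d∈
  ... | d∈range , (d∣n , _) with ∈-map⁻ suc d∈range
  ...   | i , i∈ , refl with ∈-applyUpTo⁻ suc i∈
  ...     | j , _ , refl = nontrivial-even (s<s z<s) d∣n
  2∤1 : ¬ 2 ∣ 1
  2∤1 2∣1 with () ← ∣1⇒≡1 2∣1

σ**[2^k]-odd : ∀ k → ¬ 2 ∣ σ** (2 ^ k)
σ**[2^k]-odd k = σ**-odd (λ d>1 d∣2ᵏ → ∣2^k⇒even k d∣2ᵏ d>1) (m^n>0 2 k)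

-- Odd prime divisors

OddPrimeDivisor : ℕ → ℕ → Set
OddPrimeDivisor n p = Prime p × p ≢ 2 × p ∣ n

2^length∣σ** : 0 < n → ∀ {ps} → Unique ps → All (OddPrimeDivisor n) ps → 2 ^ length ps ∣ σ** n
2^length∣σ**     n>0 []            []                       = 1∣ _
2^length∣σ** {n} n>0 {p ∷ ps} (p∉ps ∷ ps!) ((pp , p≢2 , p∣n) ∷ ps⊆) with factorOut pp n>0
... | zero  , m , n≡m , p∤m = ⊥-elim (p∤m (subst (p ∣_) (trans n≡m (*-identityˡ m)) p∣n))
... | suc e , m , n≡pᵉm , p∤m = subst (2 ^ length (p ∷ ps) ∣_) (sym σ**n≡)
      (*-pres-∣ (σ**-even pᵉ>1 2∤pᵉ) (2^length∣σ** m>0 ps! (All.zipWith divides-m (p∉ps , ps⊆))))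
  where
  pᵉ>0 = m*n>0⇒m>0 (p ^ suc e) (subst (0 <_) n≡pᵉm n>0)
  m>0  = m*n>0⇒n>0 (p ^ suc e) (subst (0 <_) n≡pᵉm n>0)
  pᵉ>1 : 1 < p ^ suc e
  pᵉ>1 = ^-monoʳ-< p (nonTrivial⇒n>1 p {{prime⇒nonTrivial pp}}) {0} {suc e} z<s
  2∤pᵉ : ¬ 2 ∣ p ^ suc e
  2∤pᵉ 2∣pᵉ = p≢2 (sym (prime∣prime^⇒≡ (suc e) prime[2] pp 2∣pᵉ))
  σ**n≡ : σ** n ≡ σ** (p ^ suc e) * σ** m
  σ**n≡ = trans (cong σ** n≡pᵉm) (σ**-multiplicative pᵉ>0 m>0 (coprime-^ˡ (suc e) (prime∤⇒coprime pp p∤m)))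
  divides-m : ∀ {q} → p ≢ q × OddPrimeDivisor n q → OddPrimeDivisor m q
  divides-m (p≢q , qp , q≢2 , q∣n) =
    qp , q≢2 , prime∣p^e*m⇒∣m (suc e) qp pp (≢-sym p≢q) (subst (_ ∣_) n≡pᵉm q∣n)

σ**-odd⇒powerOf2 : 0 < n → ¬ 2 ∣ σ** n → ∃[ k ] n ≡ 2 ^ k
σ**-odd⇒powerOf2 {n} n>0 2∤σ** with factorOut prime[2] n>0
... | k , m , n≡2ᵏm , 2∤m with m ≟ 1
...   | yes refl = k , trans n≡2ᵏm (*-identityʳ (2 ^ k))
...   | no m≢1 with primeFactor (≤∧≢⇒< (m*n>0⇒n>0 (2 ^ k) (subst (0 <_) n≡2ᵏm n>0)) (≢-sym m≢1))
...     | p , pp , p∣m = ⊥-elim (2∤σ** (2^length∣σ** n>0 ([] ∷ [])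
            ((pp , (λ { refl → 2∤m p∣m }) , subst (p ∣_) (sym n≡2ᵏm) (∣n⇒∣m*n (2 ^ k) p∣m)) ∷ [])))

primeDivisors : ℕ → List ℕ
primeDivisors n = filter (λ p → prime? p ×-dec p ∣? n) (upTo (suc n))

primeDivisors-unique : ∀ n → Unique (primeDivisors n)
primeDivisors-unique n = Unique.filter⁺ (λ p → prime? p ×-dec p ∣? n) (Unique.upTo⁺ (suc n))

primeDivisors-prime∣ : ∀ n → All (λ p → Prime p × p ∣ n) (primeDivisors n)
primeDivisors-prime∣ n = all-filter (λ p → prime? p ×-dec p ∣? n) (upTo (suc n))

2^ω∣σ** : 0 < n → ¬ 2 ∣ n → 2 ^ ω n ∣ σ** n
2^ω∣σ** {n} n>0 2∤n = 2^length∣σ** n>0 (primeDivisors-unique n)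
  (All.map (λ (pp , p∣n) → pp , (λ { refl → 2∤n p∣n }) , p∣n) (primeDivisors-prime∣ n))

2^[ω∸1]∣σ** : 0 < n → 2 ^ (ω n ∸ 1) ∣ σ** n
2^[ω∸1]∣σ** {n} n>0 =
  ∣-trans (^-monoʳ-∣ 2 (∸-monoˡ-≤ 1 (length≤1+length-filter-≢ (primeDivisors-unique n))))
          (2^length∣σ** n>0 (Unique.filter⁺ ≢2? (primeDivisors-unique n))
            (All.zipWith (λ (p≢2 , pp , p∣n) → pp , p≢2 , p∣n)
                         (all-filter ≢2? (primeDivisors n) , All.filter⁺ ≢2? (primeDivisors-prime∣ n))))
  where ≢2? = λ p → ¬? (p ≟ 2)

lemma2p1 : ∀ (n : ℕ) → 0 < n →
    ((¬ 2 ∣ σ** n) ⇔ (∃[ k ] n ≡ 2 ^ k))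
    × ((¬ 2 ∣ n) → 2 ^ ω n ∣ σ** n)
    × (2 ∣ n → 2 ^ (ω n ∸ 1) ∣ σ** n)
lemma2p1 n n>0 =
  mk⇔ (σ**-odd⇒powerOf2 n>0) (λ (k , n≡2ᵏ) → subst (λ t → ¬ 2 ∣ σ** t) (sym n≡2ᵏ) (σ**[2^k]-odd k)) ,
  2^ω∣σ** n>0 ,
  λ _ → 2^[ω∸1]∣σ** n>0
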